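{- Let $(B,\prec,\Diamond)$ be a finitely additive modal contact algebra, let $\Box:=\neg\Diamond\neg$, and define $a\rightsquigarrow b=1$ if $a\prec b$ and $a\rightsquigarrow b=0$ otherwise. Consider the first-order sentences $\Pi(\rho6)$: $\forall x_1,x_2,z\,\big((x_1\rightsquigarrow x_2)\not\le z\Rightarrow\exists y\,((x_1\rightsquigarrow y)\wedge(y\rightsquigarrow x_2))\not\le z\big)$; $\Pi(\rho7)$: $\forall x,z\,\big(x\not\le z\Rightarrow\exists y\,((y\rightsquigarrow x)\wedge y)\not\le z\big)$; $\Pi(\mathrm{UC})$: $\forall x,z\,\big(\Box x\not\le z\Rightarrow\exists y\,((y\rightsquigarrow x)\wedge\Box y)\not\le z\big)$. Then (1) $(B,\rightsquigarrow,\Diamond)$ satisfies $\Pi(\rho6)$ and $\Pi(\rho7)$ iff $(B,\prec,\Diamond)$ is a modal compingent algebra; (2) $(B,\rightsquigarrow,\Diamond)$ satisfies $\Pi(\mathrm{UC})$ iff $\Diamond$ is upper continuous.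
   Context: A contact algebra is $(B,\prec)$ with $B$ Boolean and $\prec$ satisfying: $0\prec0$, $1\prec1$; $a\prec b,a\prec c\Rightarrow a\prec b\wedge c$; $a\prec c,b\prec c\Rightarrow a\vee b\prec c$; $a\le b\prec c\le d\Rightarrow a\prec d$; $a\prec b\Rightarrow a\le b$; $a\prec b\Rightarrow\neg b\prec\neg a$. It is compingent if moreover $a\prec b$ implies $a\prec c\prec b$ for some $c$, and $a\ne0$ implies $b\prec a$ for some $b\ne0$. An operator $\Diamond$ is de Vries additive if $\Diamond0=0$ and $a_1\prec b_1,a_2\prec b_2$ imply $\Diamond(a_1\vee a_2)\prec\Diamond b_1\vee\Diamond b_2$. A finitely additive modal contact algebra is $(B,\prec,\Diamond)$ with $(B,\prec)$ contact and $\Diamond$ de Vries additive and preserving finite joins; it is a modal compingent algebra if $(B,\prec)$ is compingent. $\Diamond$ is upper continuous if for each $a$ the meet of $\{\Diamond b:a\prec b\}$ exists and equals $\Diamond a$. -}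

module Defs where

open import Level using (0ℓ)
open import Data.Bool using (true; false)
open import Data.Product using (Σ; _×_; ∃; ∃-syntax)
open import Relation.Nullary using (¬_; Dec; does)
open import Relation.Binary.PropositionalEquality using ()
open import Algebra.Lattice.Bundles using (BooleanAlgebra)
open import Axiom.ExcludedMiddle using (ExcludedMiddle)

module _ (B : BooleanAlgebra 0ℓ 0ℓ) where
  open BooleanAlgebra B renaming (¬_ to ∁)

  _≤_ : Carrier → Carrier → Set
  x ≤ y = (x ∧ y) ≈ x

  _≰_ : Carrier → Carrier → Set
  x ≰ y = ¬ (x ≤ y)

  record IsContact (_≺_ : Carrier → Carrier → Set) : Set where
    field
      ≺-⊥ : ⊥ ≺ ⊥
      ≺-⊤ : ⊤ ≺ ⊤
      ≺-∧ : ∀ {a b c} → a ≺ b → a ≺ c → a ≺ (b ∧ c)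
      ≺-∨ : ∀ {a b c} → a ≺ c → b ≺ c → (a ∨ b) ≺ c
      ≺-mono : ∀ {a b c d} → a ≤ b → b ≺ c → c ≤ d → a ≺ d
      ≺⇒≤ : ∀ {a b} → a ≺ b → a ≤ b
      ≺-¬ : ∀ {a b} → a ≺ b → (∁ b) ≺ (∁ a)

  record IsCompingent (_≺_ : Carrier → Carrier → Set) : Set where
    field
      isContact : IsContact _≺_
      interpolate : ∀ {a b} → a ≺ b → ∃[ c ] ((a ≺ c) × (c ≺ b))
      approx : ∀ {a} → ¬ (a ≈ ⊥) → ∃[ b ] ((¬ (b ≈ ⊥)) × (b ≺ a))

  IsDeVriesAdditive : (Carrier → Carrier → Set) → (Carrier → Carrier) → Set
  IsDeVriesAdditive _≺_ ◇ =
    (◇ ⊥ ≈ ⊥) ×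
    (∀ {a₁ b₁ a₂ b₂} → a₁ ≺ b₁ → a₂ ≺ b₂ → ◇ (a₁ ∨ a₂) ≺ (◇ b₁ ∨ ◇ b₂))

  -- finitely additive modal contact algebra (B, ≺, ◇)
  -- (◇ is a function on the setoid carrier, so we require it to respect ≈)
  record IsFAModalContactAlgebra (_≺_ : Carrier → Carrier → Set)
                                 (◇ : Carrier → Carrier) : Set where
    field
      isContact : IsContact _≺_
      ◇-cong : ∀ {a b} → a ≈ b → ◇ a ≈ ◇ b
      deVries : IsDeVriesAdditive _≺_ ◇
      ◇-⊥ : ◇ ⊥ ≈ ⊥
      ◇-∨ : ∀ a b → ◇ (a ∨ b) ≈ (◇ a ∨ ◇ b)

  record IsModalCompingentAlgebra (_≺_ : Carrier → Carrier → Set)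
                                  (◇ : Carrier → Carrier) : Set where
    field
      isFAMCA : IsFAModalContactAlgebra _≺_ ◇
      isCompingent : IsCompingent _≺_

  UpperContinuous : (Carrier → Carrier → Set) → (Carrier → Carrier) → Set
  UpperContinuous _≺_ ◇ = ∀ a →
    (∀ b → a ≺ b → ◇ a ≤ ◇ b) ×
    (∀ c → (∀ b → a ≺ b → c ≤ ◇ b) → c ≤ ◇ a)

  □ : (Carrier → Carrier) → Carrier → Carrier
  □ ◇ x = ∁ (◇ (∁ x))

  module _ (lem : ExcludedMiddle 0ℓ) (_≺_ : Carrier → Carrier → Set) where
    _⇝_ : Carrier → Carrier → Carrier
    a ⇝ b with does (lem {a ≺ b})
    ... | true = ⊤
    ... | false = ⊥

    Πρ6 : Set
    Πρ6 = ∀ x₁ x₂ z → (x₁ ⇝ x₂) ≰ z →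
            ∃[ y ] (((x₁ ⇝ y) ∧ (y ⇝ x₂)) ≰ z)

    Πρ7 : Set
    Πρ7 = ∀ x z → x ≰ z → ∃[ y ] (((y ⇝ x) ∧ y) ≰ z)

    ΠUC : (Carrier → Carrier) → Set
    ΠUC ◇ = ∀ x z → □ ◇ x ≰ z → ∃[ y ] (((y ⇝ x) ∧ □ ◇ y) ≰ z)

-- Since a ⇝ b is ⊤ when a ≺ b and ⊥ otherwise, an inequality (a ⇝ b) ∧ w ≰ z says exactly
-- that a ≺ b and w ≰ z. Read this way, Π(ρ6) is interpolation, Π(ρ7) is approximation from
-- below (applied to x ∧ ¬ z, which is nonzero iff x ≰ z), and Π(UC) is upper continuity of ◇
-- at ¬ x, because □ x ≤ z iff ¬ z ≤ ◇ ¬ x.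
module Submission where

open import Defs hiding (_≤_; _≰_; _⇝_)
open import Level using (0ℓ)
open import Data.Product using (_×_; _,_; proj₁; proj₂; ∃-syntax)
open import Function.Base using (_∘_)
open import Function.Bundles using (_⇔_; mk⇔; module Equivalence)
open import Relation.Nullary using (¬_; yes; no; contradiction)
open import Relation.Nullary.Decidable using (decidable-stable)
open import Relation.Binary.Lattice.Bundles using (MeetSemilattice)
open import Algebra.Lattice.Bundles using (BooleanAlgebra)
open import Axiom.ExcludedMiddle using (ExcludedMiddle)
import Algebra.Lattice.Properties.BooleanAlgebra as BooleanAlgebraProperties

open Equivalence using (to; from)

module BooleanAlgebraOrder (B : BooleanAlgebra 0ℓ 0ℓ) where

  open BooleanAlgebra B renaming (¬_ to ∁)
  open BooleanAlgebraProperties B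
  open import Relation.Binary.Reasoning.Setoid setoid
  private module Meet = MeetSemilattice ∧-orderTheoreticMeetSemilattice

  infix 4 _≤_ _≰_

  _≤_ : Carrier → Carrier → Set
  _≤_ = Defs._≤_ B

  _≰_ : Carrier → Carrier → Set
  _≰_ = Defs._≰_ B

  -- The library's natural order is x ≈ x ∧ y, the symmetric form of ours.
  ≤-reflexive : ∀ {x y} → x ≈ y → x ≤ y
  ≤-reflexive = sym ∘ Meet.reflexive

  ≤-refl : ∀ {x} → x ≤ x
  ≤-refl = ≤-reflexive refl

  ≤-trans : ∀ {x y z} → x ≤ y → y ≤ z → x ≤ z
  ≤-trans p q = sym (Meet.trans (sym p) (sym q))

  ≤-respˡ-≈ : ∀ {x y z} → y ≈ z → y ≤ x → z ≤ x
  ≤-respˡ-≈ y≈z = ≤-trans (≤-reflexive (sym y≈z))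

  ≤-respʳ-≈ : ∀ {x y z} → y ≈ z → x ≤ y → x ≤ z
  ≤-respʳ-≈ y≈z x≤y = ≤-trans x≤y (≤-reflexive y≈z)

  x∧y≤x : ∀ x y → x ∧ y ≤ x
  x∧y≤x x y = sym (Meet.x∧y≤x x y)

  x∧y≤y : ∀ x y → x ∧ y ≤ y
  x∧y≤y x y = sym (Meet.x∧y≤y x y)

  ∧-greatest : ∀ {x y z} → x ≤ y → x ≤ z → x ≤ y ∧ z
  ∧-greatest p q = sym (Meet.∧-greatest (sym p) (sym q))

  ⊥≤x : ∀ x → ⊥ ≤ x
  ⊥≤x = ∧-zeroˡ

  x≤⊤ : ∀ x → x ≤ ⊤
  x≤⊤ = ∧-identityʳ

  x≤⊥⇒x≈⊥ : ∀ {x} → x ≤ ⊥ → x ≈ ⊥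
  x≤⊥⇒x≈⊥ {x} p = trans (sym p) (∧-zeroʳ x)

  x≤y⇒x∨y≈y : ∀ {x y} → x ≤ y → x ∨ y ≈ y
  x≤y⇒x∨y≈y {x} {y} p = begin
    x ∨ y        ≈⟨ ∨-congʳ (sym p) ⟩
    (x ∧ y) ∨ y  ≈⟨ ∨-comm _ y ⟩
    y ∨ (x ∧ y)  ≈⟨ ∨-congˡ (∧-comm x y) ⟩
    y ∨ (y ∧ x)  ≈⟨ ∨-absorbs-∧ y x ⟩
    y            ∎

  x∧∁y≈⊥⇒x≤y : ∀ {x y} → x ∧ ∁ y ≈ ⊥ → x ≤ y
  x∧∁y≈⊥⇒x≤y {x} {y} e = sym (begin
    x                      ≈⟨ sym (∧-identityʳ x) ⟩
    x ∧ ⊤                  ≈⟨ ∧-congˡ (sym (∨-complementʳ y)) ⟩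
    x ∧ (y ∨ ∁ y)          ≈⟨ ∧-distribˡ-∨ x y (∁ y) ⟩
    (x ∧ y) ∨ (x ∧ ∁ y)    ≈⟨ ∨-congˡ e ⟩
    (x ∧ y) ∨ ⊥            ≈⟨ ∨-identityʳ _ ⟩
    x ∧ y                  ∎)

  ∁-antitone : ∀ {x y} → x ≤ y → ∁ y ≤ ∁ x
  ∁-antitone {x} {y} p = begin
    ∁ y ∧ ∁ x  ≈⟨ deMorgan₂ y x ⟨
    ∁ (y ∨ x)  ≈⟨ ¬-cong (∨-comm y x) ⟩
    ∁ (x ∨ y)  ≈⟨ ¬-cong (x≤y⇒x∨y≈y p) ⟩
    ∁ y        ∎

  ∁-≤-∁⇔ : ∀ {x y} → ∁ x ≤ ∁ y ⇔ y ≤ x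
  ∁-≤-∁⇔ = mk⇔
    (λ p → ≤-respʳ-≈ (¬-involutive _) (≤-respˡ-≈ (¬-involutive _) (∁-antitone p)))
    ∁-antitone

  ∁-≤-swap : ∀ {x y} → ∁ x ≤ y → ∁ y ≤ x
  ∁-≤-swap p = to ∁-≤-∁⇔ (≤-respʳ-≈ (sym (¬-involutive _)) p)

  ∨-homomorphic⇒monotone : ∀ {f : Carrier → Carrier} →
    (∀ {x y} → x ≈ y → f x ≈ f y) → (∀ x y → f (x ∨ y) ≈ f x ∨ f y) →
    ∀ {x y} → x ≤ y → f x ≤ f y
  ∨-homomorphic⇒monotone {f} f-cong f-∨ {x} {y} p = begin
    f x ∧ f y          ≈⟨ ∧-congˡ (f-cong (x≤y⇒x∨y≈y p)) ⟨
    f x ∧ f (x ∨ y)    ≈⟨ ∧-congˡ (f-∨ x y) ⟩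
    f x ∧ (f x ∨ f y)  ≈⟨ ∧-absorbs-∨ (f x) (f y) ⟩
    f x                ∎

module Indicator (lem : ExcludedMiddle 0ℓ) (B : BooleanAlgebra 0ℓ 0ℓ)
    (_≺_ : BooleanAlgebra.Carrier B → BooleanAlgebra.Carrier B → Set) where

  open BooleanAlgebra B renaming (¬_ to ∁)
  open BooleanAlgebraProperties B using (∧-identityˡ; ∧-zeroˡ)
  open BooleanAlgebraOrder B

  _⇝_ : Carrier → Carrier → Carrier
  _⇝_ = Defs._⇝_ B lem _≺_

  ⇝-≰⇔ : ∀ {a b z} → (a ⇝ b) ≰ z ⇔ (a ≺ b × ⊤ ≰ z)
  ⇝-≰⇔ {a} {b} {z} with lem {a ≺ b}
  ... | yes a≺b = mk⇔ (a≺b ,_) proj₂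
  ... | no a⊀b = mk⇔ (contradiction (⊥≤x z)) (λ (a≺b , _) → contradiction a≺b a⊀b)

  ⇝∧-≰⇔ : ∀ {a b w z} → (a ⇝ b) ∧ w ≰ z ⇔ (a ≺ b × w ≰ z)
  ⇝∧-≰⇔ {a} {b} {w} {z} with lem {a ≺ b}
  ... | yes a≺b = mk⇔
    (λ ⊤∧w≰z → a≺b , ⊤∧w≰z ∘ ≤-respˡ-≈ (sym (∧-identityˡ w)))
    (λ (_ , w≰z) → w≰z ∘ ≤-respˡ-≈ (∧-identityˡ w))
  ... | no a⊀b = mk⇔
    (contradiction (≤-respˡ-≈ (sym (∧-zeroˡ w)) (⊥≤x z)))
    (λ (a≺b , _) → contradiction a≺b a⊀b)

module FirstOrderConditions (lem : ExcludedMiddle 0ℓ) (B : BooleanAlgebra 0ℓ 0ℓ)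
    {_≺_ : BooleanAlgebra.Carrier B → BooleanAlgebra.Carrier B → Set}
    (isContact : IsContact B _≺_) where

  open BooleanAlgebra B renaming (¬_ to ∁)
  open BooleanAlgebraProperties B using (¬-involutive)
  open BooleanAlgebraOrder B
  open Indicator lem B _≺_
  open IsContact isContact

  Interpolative : Set
  Interpolative = ∀ {a b} → a ≺ b → ∃[ c ] ((a ≺ c) × (c ≺ b))

  ApproximableFromBelow : Set
  ApproximableFromBelow = ∀ {a} → ¬ (a ≈ ⊥) → ∃[ b ] ((¬ (b ≈ ⊥)) × (b ≺ a))

  ≺-∁ˡ : ∀ {a b} → ∁ a ≺ b → ∁ b ≺ a
  ≺-∁ˡ ∁a≺b = ≺-mono ≤-refl (≺-¬ ∁a≺b) (≤-reflexive (¬-involutive _))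

  ≺-∁ʳ : ∀ {a b} → a ≺ ∁ b → b ≺ ∁ a
  ≺-∁ʳ a≺∁b = ≺-mono (≤-reflexive (sym (¬-involutive _))) (≺-¬ a≺∁b) ≤-refl

  -- In the one-element algebra no z witnesses ⊤ ≰ z, but there b ≤ a and c = b interpolates.
  Πρ6⇔interpolative : Πρ6 B lem _≺_ ⇔ Interpolative
  Πρ6⇔interpolative = mk⇔ Πρ6⇒interpolative interpolative⇒Πρ6
    where
    Πρ6⇒interpolative : Πρ6 B lem _≺_ → Interpolative
    Πρ6⇒interpolative ρ6 {a} {b} a≺b with lem {⊤ ≤ ⊥}
    ... | yes ⊤≤⊥ = b , a≺b , ≺-mono b≤a a≺b ≤-refl
      where
      b≤a : b ≤ a
      b≤a = ≤-trans (x≤⊤ b) (≤-trans ⊤≤⊥ (⊥≤x a))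
    ... | no ⊤≰⊥ =
      let y , ⇝y∧y⇝≰⊥ = ρ6 a b ⊥ (from ⇝-≰⇔ (a≺b , ⊤≰⊥))
          a≺y , y⇝b≰⊥ = to ⇝∧-≰⇔ ⇝y∧y⇝≰⊥
      in y , a≺y , proj₁ (to ⇝-≰⇔ y⇝b≰⊥)

    interpolative⇒Πρ6 : Interpolative → Πρ6 B lem _≺_
    interpolative⇒Πρ6 interpolate x₁ x₂ z x₁⇝x₂≰z =
      let x₁≺x₂ , ⊤≰z = to ⇝-≰⇔ x₁⇝x₂≰z
          c , x₁≺c , c≺x₂ = interpolate x₁≺x₂
      in c , from ⇝∧-≰⇔ (x₁≺c , from ⇝-≰⇔ (c≺x₂ , ⊤≰z))

  Πρ7⇔approximableFromBelow : Πρ7 B lem _≺_ ⇔ ApproximableFromBelow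
  Πρ7⇔approximableFromBelow = mk⇔ Πρ7⇒approximable approximable⇒Πρ7
    where
    Πρ7⇒approximable : Πρ7 B lem _≺_ → ApproximableFromBelow
    Πρ7⇒approximable ρ7 {a} a≉⊥ =
      let y , y⇝a∧y≰⊥ = ρ7 a ⊥ (a≉⊥ ∘ x≤⊥⇒x≈⊥)
          y≺a , y≰⊥ = to ⇝∧-≰⇔ y⇝a∧y≰⊥
      in y , y≰⊥ ∘ ≤-reflexive , y≺a

    approximable⇒Πρ7 : ApproximableFromBelow → Πρ7 B lem _≺_
    approximable⇒Πρ7 approximate x z x≰z =
      let b , b≉⊥ , b≺x∧∁z = approximate (x≰z ∘ x∧∁y≈⊥⇒x≤y)
          b≤∁z = ≤-trans (≺⇒≤ b≺x∧∁z) (x∧y≤y x (∁ z))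
          b≰z = λ b≤z → b≉⊥ (x≤⊥⇒x≈⊥ (≤-respʳ-≈ (∧-complementʳ z) (∧-greatest b≤z b≤∁z)))
      in b , from ⇝∧-≰⇔ (≺-mono ≤-refl b≺x∧∁z (x∧y≤x x (∁ z)) , b≰z)

  Πρ6×Πρ7⇔isCompingent : (Πρ6 B lem _≺_ × Πρ7 B lem _≺_) ⇔ IsCompingent B _≺_
  Πρ6×Πρ7⇔isCompingent = mk⇔
    (λ (ρ6 , ρ7) → record
      { isContact = isContact
      ; interpolate = to Πρ6⇔interpolative ρ6
      ; approx = to Πρ7⇔approximableFromBelow ρ7
      })
    (λ compingent → from Πρ6⇔interpolative (IsCompingent.interpolate compingent)
                  , from Πρ7⇔approximableFromBelow (IsCompingent.approx compingent))

  module _ {◇ : Carrier → Carrier} (◇-mono : ∀ {x y} → x ≤ y → ◇ x ≤ ◇ y) where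

    ◇∁∁-≤ : ∀ a → ◇ (∁ (∁ a)) ≤ ◇ a
    ◇∁∁-≤ a = ◇-mono (≤-reflexive (¬-involutive a))

    ΠUC⇔upperContinuous : ΠUC B lem _≺_ ◇ ⇔ UpperContinuous B _≺_ ◇
    ΠUC⇔upperContinuous = mk⇔ ΠUC⇒upperContinuous upperContinuous⇒ΠUC
      where
      ΠUC⇒upperContinuous : ΠUC B lem _≺_ ◇ → UpperContinuous B _≺_ ◇
      ΠUC⇒upperContinuous uc a = (λ _ a≺b → ◇-mono (≺⇒≤ a≺b)) , greatest
        where
        greatest : ∀ c → (∀ b → a ≺ b → c ≤ ◇ b) → c ≤ ◇ a
        greatest c lower = decidable-stable lem λ c≰◇a →
          let y , y⇝∁a∧□y≰∁c = uc (∁ a) (∁ c) λ □∁a≤∁c →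
                c≰◇a (≤-trans (to ∁-≤-∁⇔ □∁a≤∁c) (◇∁∁-≤ a))
              y≺∁a , □y≰∁c = to ⇝∧-≰⇔ y⇝∁a∧□y≰∁c
          in □y≰∁c (from ∁-≤-∁⇔ (lower (∁ y) (≺-∁ʳ y≺∁a)))

      upperContinuous⇒ΠUC : UpperContinuous B _≺_ ◇ → ΠUC B lem _≺_ ◇
      upperContinuous⇒ΠUC uc x z □x≰z = decidable-stable lem λ no-witness →
        □x≰z (∁-≤-swap (proj₂ (uc (∁ x)) (∁ z) λ b ∁x≺b → decidable-stable lem λ ∁z≰◇b →
          no-witness (∁ b , from ⇝∧-≰⇔ (≺-∁ˡ ∁x≺b , λ □∁b≤z →
            ∁z≰◇b (≤-trans (∁-≤-swap □∁b≤z) (◇∁∁-≤ b))))))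

proposition3p8 : (lem : ExcludedMiddle 0ℓ) (B : BooleanAlgebra 0ℓ 0ℓ)
    (_≺_ : BooleanAlgebra.Carrier B → BooleanAlgebra.Carrier B → Set)
    (◇ : BooleanAlgebra.Carrier B → BooleanAlgebra.Carrier B) →
    IsFAModalContactAlgebra B _≺_ ◇ →
    ((Πρ6 B lem _≺_ × Πρ7 B lem _≺_) ⇔ IsModalCompingentAlgebra B _≺_ ◇)
    × (ΠUC B lem _≺_ ◇ ⇔ UpperContinuous B _≺_ ◇)
proposition3p8 lem B _≺_ ◇ fama =
  mk⇔ (λ ρ → record { isFAMCA = fama ; isCompingent = to Πρ6×Πρ7⇔isCompingent ρ })
      (from Πρ6×Πρ7⇔isCompingent ∘ IsModalCompingentAlgebra.isCompingent)
  , ΠUC⇔upperContinuous (BooleanAlgebraOrder.∨-homomorphic⇒monotone B ◇-cong ◇-∨)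
  where
  open IsFAModalContactAlgebra fama
  open FirstOrderConditions lem B isContact
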